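{- There is an absolute constant $C$ such that for all sufficiently large $d$, all nonnegative integers $a,g,b,h$ with $a\le\alpha^d$, every $A\in\mathcal{H}(a,g,b,h)$ and every approximating quadruple $(F,S,P,Q)$ for $A$, $$|S|\le|F|+Cg/\sqrt d\qquad\text{and}\qquad |Q|\le|P|+Ch/\sqrt d.$$
   Context: $Q_d$ is the Hamming cube on $V=\{0,1\}^d$ (adjacent iff differing in one coordinate); $\mathcal{E}$ (resp. $\mathcal{O}$) is the set of vertices with an even (resp. odd) number of ones. $\alpha<2$ is a fixed absolute constant. $N(A)$ is the set of vertices adjacent to some vertex of $A$; $B(A)=\{v\in V:N(v)\subseteq A\}$; $d_C(u)$ is the number of neighbours of $u$ in $C$. A set is $2$-linked if any two of its elements are joined by a sequence of its elements with consecutive elements at graph distance at most $2$. $\mathcal{H}(a,g,b,h)$ is the set of $2$-linked $A\subseteq\mathcal{E}$ with $|A|=a$, $|N(A)|=g$, $|B(A)|=b$, $|N(B(A))|=h$. For $A\subseteq\mathcal{E}$ write $G=N(A)$, $B=B(A)$, $H=N(B)$. An approximating quadruple for $A$ is $(F,S,P,Q)\in2^{\mathcal{O}}\times2^{\mathcal{E}}\times2^{\mathcal{E}}\times2^{\mathcal{O}}$ with: $F\subseteq G$, $S\supseteq A$; $d_F(u)>d-\sqrt d$ for all $u\in S$; $d_{\mathcal{E}\setminus S}(v)>d-\sqrt d$ for all $v\in\mathcal{O}\setminus F$; $P\subseteq H$, $Q\supseteq B$; $d_P(u)>d-\sqrt d$ for all $u\in Q$; $d_{\mathcal{O}\setminus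 Q}(v)>d-\sqrt d$ for all $v\in\mathcal{E}\setminus P$. -}

module Defs where

open import Data.Bool using (Bool; true; false; _∧_; not; if_then_else_)
open import Data.Nat using (ℕ; zero; suc; _+_; _*_; _∸_; _^_; _≤_; _<_)
open import Data.Nat.Properties using (_≟_)
open import Data.Nat.Base using (_%_)
open import Data.Vec using (Vec; []; _∷_; zipWith; count)
open import Data.List using (List; []; _∷_; _++_; map; filter; length)
open import Data.Bool.ListAction using (any; all)
open import Data.Product using (Σ; _×_; _,_)
open import Data.Sum using (_⊎_)
open import Relation.Binary.PropositionalEquality using (_≡_)
open import Relation.Nullary.Decidable using (⌊_⌋)
open import Data.Bool.Properties using () renaming (_≟_ to _≟ᵇ_)

-- Vertices of the Hamming cube Q_d : V = {0,1}^d  (true = 1)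
V : ℕ → Set
V d = Vec Bool d

allV : (d : ℕ) → List (V d)
allV zero = [] ∷ []
allV (suc d) = map (false ∷_) (allV d) ++ map (true ∷_) (allV d)

ones : ∀ {d} → V d → ℕ
ones [] = 0
ones (true ∷ v) = suc (ones v)
ones (false ∷ v) = ones v

hamming : ∀ {d} → V d → V d → ℕ
hamming [] [] = 0
hamming (x ∷ u) (y ∷ v) = (if ⌊ x ≟ᵇ y ⌋ then 0 else 1) + hamming u v

Adj : ∀ {d} → V d → V d → Set
Adj u v = hamming u v ≡ 1

adjᵇ : ∀ {d} → V d → V d → Bool
adjᵇ u v = ⌊ hamming u v ≟ 1 ⌋

Dist≤2 : ∀ {d} → V d → V d → Set
Dist≤2 {d} u v = u ≡ v ⊎ Adj u v ⊎ Σ (V d) (λ w → Adj u w × Adj w v)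

VSet : ℕ → Set
VSet d = V d → Bool

_∈_ : ∀ {d} → V d → VSet d → Set
v ∈ X = X v ≡ true

_⊆_ : ∀ {d} → VSet d → VSet d → Set
X ⊆ Y = ∀ v → v ∈ X → v ∈ Y

∣_∣ : ∀ {d} → VSet d → ℕ
∣_∣ {d} X = length (filter (λ v → X v ≟ᵇ true) (allV d))

𝓔 : ∀ {d} → VSet d
𝓔 v = ⌊ ones v % 2 ≟ 0 ⌋

𝓞 : ∀ {d} → VSet d
𝓞 v = not (𝓔 v)

_∖_ : ∀ {d} → VSet d → VSet d → VSet d
(X ∖ Y) v = X v ∧ not (Y v)

N : ∀ {d} → VSet d → VSet d
N {d} A v = any (λ u → A u ∧ adjᵇ u v) (allV d)

Bd : ∀ {d} → VSet d → VSet d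
Bd {d} A v = all (λ u → if adjᵇ u v then A u else true) (allV d)

deg : ∀ {d} → VSet d → V d → ℕ
deg {d} C u = length (filter (λ v → (C v ∧ adjᵇ u v) ≟ᵇ true) (allV d))

-- "d_C(u) > d - √d"  ⇔  (d - d_C(u))² < d   (note d_C(u) ≤ d)
BigDeg : (d : ℕ) → VSet d → V d → Set
BigDeg d C u = (d ∸ deg C u) * (d ∸ deg C u) < d

data Chain {d} (A : VSet d) : V d → V d → Set where
  here : ∀ {x} → x ∈ A → Chain A x x
  step : ∀ {x y z} → Chain A x y → z ∈ A → Dist≤2 y z → Chain A x z

TwoLinked : ∀ {d} → VSet d → Set
TwoLinked A = ∀ x y → x ∈ A → y ∈ A → Chain A x y

InH : (d a g b h : ℕ) → VSet d → Set
InH d a g b h A =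
  TwoLinked A × A ⊆ 𝓔 × ∣ A ∣ ≡ a × ∣ N A ∣ ≡ g × ∣ Bd A ∣ ≡ b × ∣ N (Bd A) ∣ ≡ h

Approx : (d : ℕ) → (A F S P Q : VSet d) → Set
Approx d A F S P Q =
  F ⊆ 𝓞 × S ⊆ 𝓔 × P ⊆ 𝓔 × Q ⊆ 𝓞 ×
  F ⊆ N A × A ⊆ S ×
  (∀ u → u ∈ S → BigDeg d F u) ×
  (∀ v → v ∈ (𝓞 ∖ F) → BigDeg d (𝓔 ∖ S) v) ×
  P ⊆ N (Bd A) × Bd A ⊆ Q ×
  (∀ u → u ∈ Q → BigDeg d P u) ×
  (∀ v → v ∈ (𝓔 ∖ P) → BigDeg d (𝓞 ∖ Q) v)

-- Every u ∈ S has deficit t(u) = d - d_F(u) < √d, and every vertex has at most d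
-- neighbours, so double counting the edges between S and F gives
-- d|S| ≤ d|F| + T with T = Σ_{u∈S} t(u).  Since T ≤ |S|√d this yields
-- |S| - |F| ≤ |S|/√d, and since 2t(u) ≤ d it also yields |S| ≤ 2|F| ≤ 2g.
-- Hence |S| - |F| ≤ 2g/√d, i.e. C = 2 works for every d ≥ 1; the same argument
-- applies to (Q, P) with P ⊆ N(B).
module Submission where

open import Defs
open import Data.Nat using (ℕ; zero; suc; _+_; _*_; _∸_; _^_; _≤_; _<_; z≤n; s≤s; NonZero; >-nonZero)
open import Data.Product using (Σ; _×_; _,_)
open import Data.Nat.Properties
open import Algebra.Properties.CommutativeSemigroup +-commutativeSemigroup
  using () renaming (interchange to +-interchange)
open import Algebra.Properties.CommutativeSemigroup *-commutativeSemigroup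
  using (x∙yz≈y∙xz) renaming (interchange to *-interchange)
open import Data.Bool using (Bool; true; false; _∧_)
open import Data.Bool.Properties using () renaming (_≟_ to _≟ᵇ_)
open import Data.List using (List; []; _∷_; _++_; map; filter; length)
open import Data.Vec using ([]; _∷_)
open import Data.Sum using (inj₁; inj₂)
open import Function using (_∘_)
open import Relation.Binary.PropositionalEquality
open import Relation.Nullary.Decidable using (⌊_⌋)
open import Data.Nat.Solver using (module +-*-Solver)
open +-*-Solver

∑ : {X : Set} → List X → (X → ℕ) → ℕ
∑ []       f = 0
∑ (x ∷ xs) f = f x + ∑ xs f

∑-syntax : {X : Set} → List X → (X → ℕ) → ℕ
∑-syntax = ∑

infix 5 ∑-syntax
syntax ∑-syntax xs (λ x → e) = ∑[ x ← xs ] e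

∑-zero : ∀ {X : Set} (xs : List X) → ∑ xs (λ _ → 0) ≡ 0
∑-zero []       = refl
∑-zero (x ∷ xs) = ∑-zero xs

module _ {X : Set} where

  ∑-cong : ∀ xs {f g : X → ℕ} → (∀ x → f x ≡ g x) → ∑ xs f ≡ ∑ xs g
  ∑-cong []       eq = refl
  ∑-cong (x ∷ xs) eq = cong₂ _+_ (eq x) (∑-cong xs eq)

  ∑-mono-≤ : ∀ xs {f g : X → ℕ} → (∀ x → f x ≤ g x) → ∑ xs f ≤ ∑ xs g
  ∑-mono-≤ []       le = z≤n
  ∑-mono-≤ (x ∷ xs) le = +-mono-≤ (le x) (∑-mono-≤ xs le)

  ∑-+ : ∀ xs (f g : X → ℕ) → ∑[ x ← xs ] (f x + g x) ≡ ∑ xs f + ∑ xs g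
  ∑-+ []       f g = refl
  ∑-+ (x ∷ xs) f g = trans (cong (f x + g x +_) (∑-+ xs f g))
                           (+-interchange (f x) (g x) (∑ xs f) (∑ xs g))

  ∑-++ : ∀ xs ys (f : X → ℕ) → ∑ (xs ++ ys) f ≡ ∑ xs f + ∑ ys f
  ∑-++ []       ys f = refl
  ∑-++ (x ∷ xs) ys f = trans (cong (f x +_) (∑-++ xs ys f)) (sym (+-assoc (f x) _ _))

  *-distribˡ-∑ : ∀ c xs (f : X → ℕ) → c * ∑ xs f ≡ ∑[ x ← xs ] (c * f x)
  *-distribˡ-∑ c []       f = *-zeroʳ c
  *-distribˡ-∑ c (x ∷ xs) f =
    trans (*-distribˡ-+ c (f x) _) (cong (c * f x +_) (*-distribˡ-∑ c xs f))

  *-distribʳ-∑ : ∀ c xs (f : X → ℕ) → ∑ xs f * c ≡ ∑[ x ← xs ] (f x * c)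
  *-distribʳ-∑ c xs f = begin
    ∑ xs f * c            ≡⟨ *-comm _ c ⟩
    c * ∑ xs f            ≡⟨ *-distribˡ-∑ c xs f ⟩
    ∑[ x ← xs ] (c * f x) ≡⟨ ∑-cong xs (λ x → *-comm c (f x)) ⟩
    ∑[ x ← xs ] (f x * c) ∎
    where open ≡-Reasoning

  ∑-*-∑ : ∀ xs (f g : X → ℕ) → ∑ xs f * ∑ xs g ≡ ∑[ x ← xs ] ∑[ y ← xs ] (f x * g y)
  ∑-*-∑ xs f g =
    trans (*-distribʳ-∑ (∑ xs g) xs f) (∑-cong xs (λ x → *-distribˡ-∑ (f x) xs g))

∑-map : ∀ {X Y : Set} xs (g : X → Y) (f : Y → ℕ) → ∑ (map g xs) f ≡ ∑ xs (f ∘ g)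
∑-map []       g f = refl
∑-map (x ∷ xs) g f = cong (f (g x) +_) (∑-map xs g f)

∑-comm : ∀ {X Y : Set} xs ys (f : X → Y → ℕ) →
  ∑[ x ← xs ] ∑[ y ← ys ] f x y ≡ ∑[ y ← ys ] ∑[ x ← xs ] f x y
∑-comm []       ys f = sym (∑-zero ys)
∑-comm (x ∷ xs) ys f =
  trans (cong (∑ ys (f x) +_) (∑-comm xs ys f))
        (sym (∑-+ ys (f x) (λ y → ∑[ x′ ← xs ] f x′ y)))

𝟙 : Bool → ℕ
𝟙 true  = 1
𝟙 false = 0

𝟙-∧ : ∀ a b → 𝟙 (a ∧ b) ≡ 𝟙 a * 𝟙 b
𝟙-∧ true  b = sym (*-identityˡ (𝟙 b))
𝟙-∧ false b = refl

𝟙*-monoʳ-≤ : ∀ b {m n} → (b ≡ true → m ≤ n) → 𝟙 b * m ≤ 𝟙 b * n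
𝟙*-monoʳ-≤ true  le = *-monoʳ-≤ 1 (le refl)
𝟙*-monoʳ-≤ false le = z≤n

𝟙*m≤m : ∀ b m → 𝟙 b * m ≤ m
𝟙*m≤m true  m = ≤-reflexive (*-identityˡ m)
𝟙*m≤m false m = z≤n

length-filter≡∑𝟙 : ∀ {X : Set} (p : X → Bool) xs →
  length (filter (λ x → p x ≟ᵇ true) xs) ≡ ∑[ x ← xs ] 𝟙 (p x)
length-filter≡∑𝟙 p []       = refl
length-filter≡∑𝟙 p (x ∷ xs) with p x
... | true  = cong suc (length-filter≡∑𝟙 p xs)
... | false = length-filter≡∑𝟙 p xs

∣∣≡∑𝟙 : ∀ {d} (X : VSet d) → ∣ X ∣ ≡ ∑[ v ← allV d ] 𝟙 (X v)
∣∣≡∑𝟙 {d} X = length-filter≡∑𝟙 X (allV d)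

∣∣-mono : ∀ {d} {Y Z : VSet d} → Y ⊆ Z → ∣ Y ∣ ≤ ∣ Z ∣
∣∣-mono {d} {Y} {Z} Y⊆Z = subst₂ _≤_ (sym (∣∣≡∑𝟙 Y)) (sym (∣∣≡∑𝟙 Z))
  (∑-mono-≤ (allV d) 𝟙Y≤𝟙Z)
  where
  𝟙Y≤𝟙Z : ∀ v → 𝟙 (Y v) ≤ 𝟙 (Z v)
  𝟙Y≤𝟙Z v with Y v in eq
  ... | true  = ≤-reflexive (cong 𝟙 (sym (Y⊆Z v eq)))
  ... | false = z≤n

∑-allV-suc : ∀ d (f : V (suc d) → ℕ) →
  ∑ (allV (suc d)) f ≡ ∑ (allV d) (f ∘ (false ∷_)) + ∑ (allV d) (f ∘ (true ∷_))
∑-allV-suc d f = begin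
  ∑ (map (false ∷_) (allV d) ++ map (true ∷_) (allV d)) f
    ≡⟨ ∑-++ (map (false ∷_) (allV d)) _ f ⟩
  ∑ (map (false ∷_) (allV d)) f + ∑ (map (true ∷_) (allV d)) f
    ≡⟨ cong₂ _+_ (∑-map (allV d) (false ∷_) f) (∑-map (allV d) (true ∷_) f) ⟩
  ∑ (allV d) (f ∘ (false ∷_)) + ∑ (allV d) (f ∘ (true ∷_)) ∎
  where open ≡-Reasoning

#atDistance : ∀ d → ℕ → V d → ℕ
#atDistance d k v = ∑[ u ← allV d ] 𝟙 ⌊ hamming u v ≟ k ⌋

#atDistance1-shift : ∀ d (v : V d) →
  ∑[ u ← allV d ] 𝟙 ⌊ suc (hamming u v) ≟ 1 ⌋ ≡ #atDistance d 0 v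
#atDistance1-shift d v = ∑-cong (allV d) (λ u → ≟1-suc (hamming u v))
  where
  ≟1-suc : ∀ h → 𝟙 ⌊ suc h ≟ 1 ⌋ ≡ 𝟙 ⌊ h ≟ 0 ⌋
  ≟1-suc zero    = refl
  ≟1-suc (suc h) = refl

#atDistance0≤1 : ∀ d (v : V d) → #atDistance d 0 v ≤ 1
#atDistance0≤1 zero    []          = ≤-refl
#atDistance0≤1 (suc d) (false ∷ v) = begin
  #atDistance (suc d) 0 (false ∷ v)       ≡⟨ ∑-allV-suc d _ ⟩
  #atDistance d 0 v + (∑[ u ← allV d ] 0) ≡⟨ cong (#atDistance d 0 v +_) (∑-zero (allV d)) ⟩
  #atDistance d 0 v + 0                   ≡⟨ +-identityʳ _ ⟩
  #atDistance d 0 v                       ≤⟨ #atDistance0≤1 d v ⟩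
  1                                       ∎
  where open ≤-Reasoning
#atDistance0≤1 (suc d) (true ∷ v)  = begin
  #atDistance (suc d) 0 (true ∷ v)        ≡⟨ ∑-allV-suc d _ ⟩
  (∑[ u ← allV d ] 0) + #atDistance d 0 v ≡⟨ cong (_+ #atDistance d 0 v) (∑-zero (allV d)) ⟩
  #atDistance d 0 v                       ≤⟨ #atDistance0≤1 d v ⟩
  1                                       ∎
  where open ≤-Reasoning

#neighbours≤d : ∀ d (v : V d) → #atDistance d 1 v ≤ d
#neighbours≤d zero    []          = ≤-refl
#neighbours≤d (suc d) (false ∷ v) = begin
  #atDistance (suc d) 1 (false ∷ v)                                 ≡⟨ ∑-allV-suc d _ ⟩
  #atDistance d 1 v + (∑[ u ← allV d ] 𝟙 ⌊ suc (hamming u v) ≟ 1 ⌋) ≡⟨ cong (#atDistance d 1 v +_) (#atDistance1-shift d v) ⟩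
  #atDistance d 1 v + #atDistance d 0 v                             ≤⟨ +-mono-≤ (#neighbours≤d d v) (#atDistance0≤1 d v) ⟩
  d + 1                                                             ≡⟨ +-comm d 1 ⟩
  suc d                                                             ∎
  where open ≤-Reasoning
#neighbours≤d (suc d) (true ∷ v)  = begin
  #atDistance (suc d) 1 (true ∷ v)                                  ≡⟨ ∑-allV-suc d _ ⟩
  (∑[ u ← allV d ] 𝟙 ⌊ suc (hamming u v) ≟ 1 ⌋) + #atDistance d 1 v ≡⟨ cong (_+ #atDistance d 1 v) (#atDistance1-shift d v) ⟩
  #atDistance d 0 v + #atDistance d 1 v                             ≤⟨ +-mono-≤ (#atDistance0≤1 d v) (#neighbours≤d d v) ⟩
  suc d                                                             ∎
  where open ≤-Reasoning

deg≡∑𝟙 : ∀ {d} (C : VSet d) u → deg C u ≡ ∑[ v ← allV d ] 𝟙 (C v) * 𝟙 (adjᵇ u v)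
deg≡∑𝟙 {d} C u = trans (length-filter≡∑𝟙 (λ v → C v ∧ adjᵇ u v) (allV d))
                       (∑-cong (allV d) (λ v → 𝟙-∧ (C v) (adjᵇ u v)))

∑deg≤d*∣∣ : ∀ {d} (C : VSet d) → ∑[ u ← allV d ] deg C u ≤ d * ∣ C ∣
∑deg≤d*∣∣ {d} C = begin
  ∑[ u ← L ] deg C u                               ≡⟨ ∑-cong L (deg≡∑𝟙 C) ⟩
  ∑[ u ← L ] ∑[ v ← L ] 𝟙 (C v) * 𝟙 (adjᵇ u v)    ≡⟨ ∑-comm L L _ ⟩
  ∑[ v ← L ] ∑[ u ← L ] 𝟙 (C v) * 𝟙 (adjᵇ u v)    ≡⟨ ∑-cong L (λ v → *-distribˡ-∑ (𝟙 (C v)) L _) ⟨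
  ∑[ v ← L ] 𝟙 (C v) * #atDistance d 1 v          ≤⟨ ∑-mono-≤ L (λ v → *-monoʳ-≤ (𝟙 (C v)) (#neighbours≤d d v)) ⟩
  ∑[ v ← L ] 𝟙 (C v) * d                          ≡⟨ *-distribʳ-∑ d L _ ⟨
  (∑[ v ← L ] 𝟙 (C v)) * d                        ≡⟨ cong (_* d) (∣∣≡∑𝟙 C) ⟨
  ∣ C ∣ * d                                        ≡⟨ *-comm ∣ C ∣ d ⟩
  d * ∣ C ∣                                        ∎
  where
  L = allV d
  open ≤-Reasoning

m*m<n⇒2*m≤n : ∀ m {n} → m * m < n → 2 * m ≤ n
m*m<n⇒2*m≤n zero          _  = z≤n
m*m<n⇒2*m≤n (suc zero)    lt = lt
m*m<n⇒2*m≤n (suc (suc m)) lt =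
  ≤-trans (*-monoˡ-≤ (suc (suc m)) (s≤s (s≤s (z≤n {m})))) (<⇒≤ lt)

m*m<o⇒n*n<o⇒m*n≤o : ∀ m n {o} → m * m < o → n * n < o → m * n ≤ o
m*m<o⇒n*n<o⇒m*n≤o m n m*m<o n*n<o with ≤-total m n
... | inj₁ m≤n = ≤-trans (*-monoˡ-≤ n m≤n) (<⇒≤ n*n<o)
... | inj₂ n≤m = ≤-trans (*-monoʳ-≤ m n≤m) (<⇒≤ m*m<o)

module Deficit {d} (X Y : VSet d) where

  deficit : V d → ℕ
  deficit u = d ∸ deg Y u

  totalDeficit : ℕ
  totalDeficit = ∑[ u ← allV d ] 𝟙 (X u) * deficit u

  ∣X∣*d≡∑𝟙*d : ∣ X ∣ * d ≡ ∑[ u ← allV d ] 𝟙 (X u) * d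
  ∣X∣*d≡∑𝟙*d = trans (cong (_* d) (∣∣≡∑𝟙 X)) (*-distribʳ-∑ d (allV d) _)

  d*∣X∣≤d*∣Y∣+totalDeficit : d * ∣ X ∣ ≤ d * ∣ Y ∣ + totalDeficit
  d*∣X∣≤d*∣Y∣+totalDeficit = begin
    d * ∣ X ∣                                           ≡⟨ trans (*-comm d ∣ X ∣) ∣X∣*d≡∑𝟙*d ⟩
    ∑[ u ← L ] 𝟙 (X u) * d                              ≤⟨ ∑-mono-≤ L (λ u → *-monoʳ-≤ (𝟙 (X u)) (m≤n+m∸n d (deg Y u))) ⟩
    ∑[ u ← L ] 𝟙 (X u) * (deg Y u + deficit u)          ≡⟨ ∑-cong L (λ u → *-distribˡ-+ (𝟙 (X u)) (deg Y u) _) ⟩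
    ∑[ u ← L ] (𝟙 (X u) * deg Y u + 𝟙 (X u) * deficit u) ≡⟨ ∑-+ L _ _ ⟩
    (∑[ u ← L ] 𝟙 (X u) * deg Y u) + totalDeficit       ≤⟨ +-monoˡ-≤ totalDeficit (∑-mono-≤ L (λ u → 𝟙*m≤m (X u) (deg Y u))) ⟩
    (∑[ u ← L ] deg Y u) + totalDeficit                 ≤⟨ +-monoˡ-≤ totalDeficit (∑deg≤d*∣∣ Y) ⟩
    d * ∣ Y ∣ + totalDeficit                            ∎
    where
    L = allV d
    open ≤-Reasoning

  module _ (bigDeg : ∀ u → u ∈ X → BigDeg d Y u) where

    2*totalDeficit≤d*∣X∣ : 2 * totalDeficit ≤ d * ∣ X ∣
    2*totalDeficit≤d*∣X∣ = begin
      2 * totalDeficit                     ≡⟨ *-distribˡ-∑ 2 L _ ⟩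
      ∑[ u ← L ] 2 * (𝟙 (X u) * deficit u) ≡⟨ ∑-cong L (λ u → x∙yz≈y∙xz 2 (𝟙 (X u)) (deficit u)) ⟩
      ∑[ u ← L ] 𝟙 (X u) * (2 * deficit u) ≤⟨ ∑-mono-≤ L (λ u → 𝟙*-monoʳ-≤ (X u) (m*m<n⇒2*m≤n (deficit u) ∘ bigDeg u)) ⟩
      ∑[ u ← L ] 𝟙 (X u) * d               ≡⟨ trans (*-comm d ∣ X ∣) ∣X∣*d≡∑𝟙*d ⟨
      d * ∣ X ∣                            ∎
      where
      L = allV d
      open ≤-Reasoning

    totalDeficit²≤∣X∣²*d : totalDeficit * totalDeficit ≤ ∣ X ∣ * ∣ X ∣ * d
    totalDeficit²≤∣X∣²*d = begin
      totalDeficit * totalDeficit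
        ≡⟨ ∑-*-∑ L _ _ ⟩
      ∑[ u ← L ] ∑[ v ← L ] (𝟙 (X u) * deficit u) * (𝟙 (X v) * deficit v)
        ≡⟨ ∑-cong L (λ u → ∑-cong L (λ v → [xy][zw]≡x[z[yw]] (𝟙 (X u)) (deficit u) (𝟙 (X v)) (deficit v))) ⟩
      ∑[ u ← L ] ∑[ v ← L ] 𝟙 (X u) * (𝟙 (X v) * (deficit u * deficit v))
        ≤⟨ ∑-mono-≤ L (λ u → ∑-mono-≤ L (λ v → 𝟙*-monoʳ-≤ (X u) (λ u∈X → 𝟙*-monoʳ-≤ (X v) (λ v∈X →
             m*m<o⇒n*n<o⇒m*n≤o (deficit u) (deficit v) (bigDeg u u∈X) (bigDeg v v∈X))))) ⟩
      ∑[ u ← L ] ∑[ v ← L ] 𝟙 (X u) * (𝟙 (X v) * d)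
        ≡⟨ ∑-cong L (λ u → ∑-cong L (λ v → sym (*-assoc (𝟙 (X u)) (𝟙 (X v)) d))) ⟩
      ∑[ u ← L ] ∑[ v ← L ] 𝟙 (X u) * 𝟙 (X v) * d
        ≡⟨ ∑-cong L (λ u → *-distribʳ-∑ d L _) ⟨
      ∑[ u ← L ] (∑[ v ← L ] 𝟙 (X u) * 𝟙 (X v)) * d
        ≡⟨ *-distribʳ-∑ d L _ ⟨
      (∑[ u ← L ] ∑[ v ← L ] 𝟙 (X u) * 𝟙 (X v)) * d
        ≡⟨ cong (_* d) (trans (cong₂ _*_ (∣∣≡∑𝟙 X) (∣∣≡∑𝟙 X)) (∑-*-∑ L _ _)) ⟨
      ∣ X ∣ * ∣ X ∣ * d
        ∎
      where
      L = allV d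
      open ≤-Reasoning
      [xy][zw]≡x[z[yw]] : ∀ x y z w → (x * y) * (z * w) ≡ x * (z * (y * w))
      [xy][zw]≡x[z[yw]] x y z w = trans (*-interchange x y z w) (*-assoc x z (y * w))

excess-bound : ∀ d s f T .{{_ : NonZero d}} →
  d * s ≤ d * f + T → 2 * T ≤ d * s → T * T ≤ s * s * d →
  (s ∸ f) * (s ∸ f) * d ≤ (2 * f) * (2 * f)
excess-bound d s f T ds≤df+T 2T≤ds T²≤s²d =
  ≤-trans excess²*d≤s² (*-mono-≤ s≤2f s≤2f)
  where
  open ≤-Reasoning
  e = s ∸ f

  d*e≤T : d * e ≤ T
  d*e≤T = subst (_≤ T) (sym (*-distribˡ-∸ d s f)) (m≤n+o⇒m∸n≤o (d * s) (d * f) ds≤df+T)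

  excess²*d≤s² : e * e * d ≤ s * s
  excess²*d≤s² = *-cancelˡ-≤ d (begin
    d * (e * e * d)   ≡⟨ solve 2 (λ d e → d :* (e :* e :* d) := (d :* e) :* (d :* e)) refl d e ⟩
    (d * e) * (d * e) ≤⟨ *-mono-≤ d*e≤T d*e≤T ⟩
    T * T             ≤⟨ T²≤s²d ⟩
    s * s * d         ≡⟨ *-comm (s * s) d ⟩
    d * (s * s)       ∎)

  s≤2f : s ≤ 2 * f
  s≤2f = *-cancelˡ-≤ d (+-cancelʳ-≤ (d * s) (d * s) (d * (2 * f)) (begin
    d * s + d * s               ≤⟨ +-mono-≤ ds≤df+T ds≤df+T ⟩
    (d * f + T) + (d * f + T)   ≡⟨ solve 3 (λ d f T → (d :* f :+ T) :+ (d :* f :+ T) := d :* (con 2 :* f) :+ con 2 :* T) refl d f T ⟩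
    d * (2 * f) + 2 * T         ≤⟨ +-monoʳ-≤ (d * (2 * f)) 2T≤ds ⟩
    d * (2 * f) + d * s         ∎))

bigDeg⇒excess-bound : ∀ {d} .{{_ : NonZero d}} {X Y Z : VSet d} → Y ⊆ Z →
  (∀ u → u ∈ X → BigDeg d Y u) →
  (∣ X ∣ ∸ ∣ Y ∣) * (∣ X ∣ ∸ ∣ Y ∣) * d ≤ 2 * 2 * (∣ Z ∣ * ∣ Z ∣)
bigDeg⇒excess-bound {d} {X} {Y} {Z} Y⊆Z bigDeg = begin
  (∣ X ∣ ∸ ∣ Y ∣) * (∣ X ∣ ∸ ∣ Y ∣) * d
    ≤⟨ excess-bound d (∣ X ∣) (∣ Y ∣) totalDeficit
         d*∣X∣≤d*∣Y∣+totalDeficit (2*totalDeficit≤d*∣X∣ bigDeg) (totalDeficit²≤∣X∣²*d bigDeg) ⟩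
  (2 * ∣ Y ∣) * (2 * ∣ Y ∣)
    ≤⟨ *-mono-≤ 2∣Y∣≤2∣Z∣ 2∣Y∣≤2∣Z∣ ⟩
  (2 * ∣ Z ∣) * (2 * ∣ Z ∣)
    ≡⟨ *-interchange 2 (∣ Z ∣) 2 (∣ Z ∣) ⟩
  2 * 2 * (∣ Z ∣ * ∣ Z ∣)
    ∎
  where
  open Deficit X Y
  open ≤-Reasoning
  2∣Y∣≤2∣Z∣ : 2 * ∣ Y ∣ ≤ 2 * ∣ Z ∣
  2∣Y∣≤2∣Z∣ = *-monoʳ-≤ 2 (∣∣-mono Y⊆Z)

approximation-bounds : ∀ {d} .{{_ : NonZero d}} {a g b h} {A F S P Q : VSet d} →
  InH d a g b h A → Approx d A F S P Q →
  ((∣ S ∣ ∸ ∣ F ∣) * (∣ S ∣ ∸ ∣ F ∣) * d ≤ 2 * 2 * (g * g)) ×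
  ((∣ Q ∣ ∸ ∣ P ∣) * (∣ Q ∣ ∸ ∣ P ∣) * d ≤ 2 * 2 * (h * h))
approximation-bounds (_ , _ , _ , refl , _ , refl)
                     (_ , _ , _ , _ , F⊆NA , _ , bigS , _ , P⊆NB , _ , bigQ , _) =
  bigDeg⇒excess-bound F⊆NA bigS , bigDeg⇒excess-bound P⊆NB bigQ

lemma7p8 : (p q : ℕ) → 0 < q → p < 2 * q →
    Σ ℕ λ C → Σ ℕ λ d₀ → ∀ d → d₀ ≤ d →
    ∀ a g b h → a * q ^ d ≤ p ^ d →
    (A : VSet d) → InH d a g b h A →
    (F S P Q : VSet d) → Approx d A F S P Q →
    ((∣ S ∣ ∸ ∣ F ∣) * (∣ S ∣ ∸ ∣ F ∣) * d ≤ C * C * (g * g)) ×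
    ((∣ Q ∣ ∸ ∣ P ∣) * (∣ Q ∣ ∸ ∣ P ∣) * d ≤ C * C * (h * h))
lemma7p8 _ _ _ _ = 2 , 1 , λ d 1≤d _ _ _ _ _ _ A∈H _ _ _ _ approx →
  approximation-bounds {{>-nonZero 1≤d}} A∈H approx
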